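{- Let $\Theta$ be a substitution schema and let $\mathcal{U}$ be a finite set of unification equations that is unifiable (in the usual syntactic first-order sense). Then $\mathrm{store}_\Theta(\mathcal{U})\neq\bot$.
   Context: Variables are objects $X_i$ with $X$ from a countably infinite set $\mathcal{V}_{sym}$ of variable symbols and $i\in\mathbb{N}$; terms are first-order terms over a signature $\Sigma$ and these variables; $\mathrm{cls}(X_i)=\{X\}$. $\mathrm{shift}_d$ adds $d$ to every variable index in a term. A substitution schema $\Theta$ is given by pairwise distinct symbols $X^1,\dots,X^n$ and terms $t_1,\dots,t_n$, and is the infinite mapping $\{X^i_j\mapsto\mathrm{shift}_j(t_i)\mid 1\le i\le n, j\ge0\}$, with $\mathrm{dom}(\Theta)=\{X^1,\dots,X^n\}$. For a variable $x$ write $x\in\Theta$ if $\mathrm{cls}(x)\subseteq\mathrm{dom}(\Theta)$, and $x\notin\Theta$ otherwise. For a term $t$, $\Theta^t$ is the substitution sending each variable $x$ of $t$ with $x\in\Theta$ to its image under $\Theta$ and fixing all other variables; $\Theta^t(0)=t$ and $\Theta^t(k+1)=s\Theta^s$ with $s=\Theta^t(k)$. $\Theta$-unification. A configuration is a pair $(\mathcal{S},\mathcal{U})$ of sets of equations (store, active set). Starting from $(\emptyset,\mathcal{U})$, the procedure first saturates the active set under: Decomposition (replace $f(r_1,\dots,r_n)\stackrel{?}{=}f(s_1,\dots,s_n)$ by the $r_i\stackrel{?}{=}s_i$); Orient-1 (replace $r\stackrel{?}{=}x$, $x$ a variable, $r$ not a variable, by $x\stackrel{?}{=}r$); Orient-2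 (for variables, if $y\stackrel{?}{=}x$ is present and $x\stackrel{?}{=}y$ not, add $x\stackrel{?}{=}y$); Transitivity (from $x\stackrel{?}{=}r$, $x\stackrel{?}{=}s$, $x$ a variable, $r\ne s$, add $r\stackrel{?}{=}s$); Reflexive (remove $t\stackrel{?}{=}t$); Clash (an equation between non-variable terms with different heads makes the procedure fail). Then Store is applied as long as possible, moving $y\stackrel{?}{=}r$ ($y$ a variable) from the active set to the store if (1) $y\in\Theta$ and, if $r$ is a variable, $r\in\Theta$; or (2) $y\notin\Theta$ and some $x\stackrel{?}{=}s'$ in the store has $y$ occurring in $s'$, or $r=x$, or $y=x$; or (3) $y\notin\Theta$ and for some variable $z\in\Theta$ occurring in the store and some $k\ge0$, $y$ occurs in $\Theta^z(k)$. Finally syntactic unification is run on store $\cup$ active set and the procedure fails if it fails (clash or occurs check). The resulting configuration is the final configuration $\mathrm{fin}_\Theta(\mathcal{U})$ and its store is $\mathrm{store}_\Theta(\mathcal{U})$; if the procedure fails, $\mathrm{store}_\Theta(\mathcal{U})=\bot$. -}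

module Defs where

open import Data.Nat using (ℕ; zero; suc; _+_)
open import Data.Nat.Properties using (_≟_)
open import Data.Product using (_×_; _,_; proj₁; proj₂; ∃; ∃-syntax; Σ-syntax)
open import Data.Product.Properties using (≡-dec)
open import Data.Sum using (_⊎_)
open import Data.Maybe using (Maybe; just; nothing)
open import Data.List using (List; []; _∷_; _++_; map)
open import Data.List.Relation.Unary.Any using (_─_)
open import Data.List.Relation.Unary.All using (All)
open import Data.List.Relation.Unary.Unique.Propositional using (Unique)
open import Data.List.Membership.Propositional using (_∈_; _∉_)
open import Data.Vec using (Vec; []; _∷_)
import Data.Vec.Relation.Unary.Any as VAny
open import Relation.Binary.PropositionalEquality using (_≡_; _≢_)
open import Relation.Binary.Construct.Closure.ReflexiveTransitive using (Star)
open import Relation.Nullary using (¬_; yes; no)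

record Signature : Set₁ where
  field
    Fun : Set
    ar  : Fun → ℕ

module Core (Sg : Signature) where
  open Signature Sg

  VSym : Set
  VSym = ℕ

  -- a variable X_i is a pair (X , i)
  Var : Set
  Var = VSym × ℕ

  -- cls(X_i) = {X}; we return the unique element X
  cls : Var → VSym
  cls = proj₁

  _≟V_ : (x y : Var) → Relation.Nullary.Dec (x ≡ y)
  _≟V_ = ≡-dec _≟_ _≟_

  data Term : Set where
    var : Var → Term
    fun : (f : Fun) → Vec Term (ar f) → Term

  IsVar : Term → Set
  IsVar t = ∃[ x ] (t ≡ var x)

  data _occursIn_ (x : Var) : Term → Set where
    here  : x occursIn var x
    there : ∀ {f ts} → VAny.Any (x occursIn_) ts → x occursIn fun f ts

  mutual
    _⟪_⟫ : Term → (Var → Term) → Term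
    var x ⟪ σ ⟫ = σ x
    fun f ts ⟪ σ ⟫ = fun f (ts ⟪ σ ⟫*)

    _⟪_⟫* : ∀ {n} → Vec Term n → (Var → Term) → Vec Term n
    [] ⟪ σ ⟫* = []
    (t ∷ ts) ⟪ σ ⟫* = (t ⟪ σ ⟫) ∷ (ts ⟪ σ ⟫*)

  shift : ℕ → Term → Term
  shift d t = t ⟪ (λ x → var (proj₁ x , proj₂ x + d)) ⟫

  [_↦_] : Var → Term → Var → Term
  [ x ↦ t ] y with x ≟V y
  ... | yes _ = t
  ... | no  _ = var y

  record Eqn : Set where
    constructor _≐_
    field
      lhs rhs : Term

  substEq : (Var → Term) → Eqn → Eqn
  substEq σ (l ≐ r) = (l ⟪ σ ⟫) ≐ (r ⟪ σ ⟫)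

  Unifier : (Var → Term) → List Eqn → Set
  Unifier σ U = All (λ e → Eqn.lhs e ⟪ σ ⟫ ≡ Eqn.rhs e ⟪ σ ⟫) U

  Unifiable : List Eqn → Set
  Unifiable U = ∃[ σ ] Unifier σ U

  zipEqs : ∀ {n} → Vec Term n → Vec Term n → List Eqn
  zipEqs [] [] = []
  zipEqs (s ∷ ss) (t ∷ ts) = (s ≐ t) ∷ zipEqs ss ts

  occursInEq : Var → Eqn → Set
  occursInEq x (l ≐ r) = x occursIn l ⊎ x occursIn r

  occursInList : Var → List Eqn → Set
  occursInList x U = ∃[ e ] (e ∈ U × occursInEq x e)

  record Schema : Set where
    field
      entries  : List (VSym × Term)
      distinct : Unique (map proj₁ entries)

  dom : Schema → List VSym
  dom Θ = map proj₁ (Schema.entries Θ)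

  _∈Θ_ : Var → Schema → Set
  x ∈Θ Θ = cls x ∈ dom Θ

  _∉Θ_ : Var → Schema → Set
  x ∉Θ Θ = ¬ (x ∈Θ Θ)

  lookupE : List (VSym × Term) → VSym → Maybe Term
  lookupE [] X = nothing
  lookupE ((Y , t) ∷ es) X with Y ≟ X
  ... | yes _ = just t
  ... | no  _ = lookupE es X

  applyΘ : Schema → Var → Term
  applyΘ Θ (X , j) with lookupE (Schema.entries Θ) X
  ... | just t  = shift j t
  ... | nothing = var (X , j)

  Θ^ : Schema → Term → ℕ → Term
  Θ^ Θ t zero = t
  Θ^ Θ t (suc k) = Θ^ Θ t k ⟪ applyΘ Θ ⟫

  data _⇒₁_ (U : List Eqn) : List Eqn → Set where
    decomposition : ∀ {f ss ts} (p : (fun f ss ≐ fun f ts) ∈ U) →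
                    U ⇒₁ (zipEqs ss ts ++ (U ─ p))
    orient-1      : ∀ {r x} (p : (r ≐ var x) ∈ U) → ¬ IsVar r →
                    U ⇒₁ ((var x ≐ r) ∷ (U ─ p))
    orient-2      : ∀ {x y} → (var y ≐ var x) ∈ U → (var x ≐ var y) ∉ U →
                    U ⇒₁ ((var x ≐ var y) ∷ U)
    transitivity  : ∀ {x r s} → (var x ≐ r) ∈ U → (var x ≐ s) ∈ U → r ≢ s →
                    U ⇒₁ ((r ≐ s) ∷ U)
    reflexive     : ∀ {t} (p : (t ≐ t) ∈ U) → U ⇒₁ (U ─ p)

  ClashIn : List Eqn → Set
  ClashIn U = ∃[ f ] ∃[ g ] ∃[ ss ] ∃[ ts ] (f ≢ g × (fun f ss ≐ fun g ts) ∈ U)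

  StoreCond : Schema → List Eqn → Var → Term → Set
  StoreCond Θ S y r =
      (y ∈Θ Θ × (∀ z → r ≡ var z → z ∈Θ Θ))
    ⊎ (y ∉Θ Θ × ∃[ x ] ∃[ s′ ] ((var x ≐ s′) ∈ S ×
                               (y occursIn s′ ⊎ r ≡ var x ⊎ y ≡ x)))
    ⊎ (y ∉Θ Θ × ∃[ z ] ∃[ k ] (z ∈Θ Θ × occursInList z S ×
                               y occursIn Θ^ Θ (var z) k))

  Config : Set
  Config = List Eqn × List Eqn   -- (store , active set)

  data _⊢_⇒s_ (Θ : Schema) : Config → Config → Set where
    store : ∀ {S A y r} (p : (var y ≐ r) ∈ A) → StoreCond Θ S y r →
            Θ ⊢ (S , A) ⇒s (((var y ≐ r) ∷ S) , (A ─ p))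

  StoreDone : Schema → Config → Set
  StoreDone Θ c = ∀ c′ → ¬ (Θ ⊢ c ⇒s c′)

  -- Phase 3: syntactic unification (Martelli–Montanari rules)
  data _⇒ᵤ_ (U : List Eqn) : List Eqn → Set where
    delete    : ∀ {t} (p : (t ≐ t) ∈ U) → U ⇒ᵤ (U ─ p)
    decompose : ∀ {f ss ts} (p : (fun f ss ≐ fun f ts) ∈ U) →
                U ⇒ᵤ (zipEqs ss ts ++ (U ─ p))
    orient    : ∀ {r x} (p : (r ≐ var x) ∈ U) → ¬ IsVar r →
                U ⇒ᵤ ((var x ≐ r) ∷ (U ─ p))
    eliminate : ∀ {x t} (p : (var x ≐ t) ∈ U) → ¬ (x occursIn t) →
                occursInList x (U ─ p) →
                U ⇒ᵤ ((var x ≐ t) ∷ map (substEq [ x ↦ t ]) (U ─ p))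

  OccursFail : List Eqn → Set
  OccursFail U = ∃[ x ] ∃[ t ] ((var x ≐ t) ∈ U × x occursIn t × t ≢ var x)

  SynFails : List Eqn → Set
  SynFails U = ∃[ U′ ] (Star _⇒ᵤ_ U U′ × (ClashIn U′ ⊎ OccursFail U′))

  StoreIsBot : Schema → List Eqn → Set
  StoreIsBot Θ U =
      (∃[ U′ ] (Star _⇒₁_ U U′ × ClashIn U′))
    ⊎ (∃[ U′ ] ∃[ S ] ∃[ A ] (Star _⇒₁_ U U′ ×
                              Star (Θ ⊢_⇒s_) ([] , U′) (S , A) ×
                              StoreDone Θ (S , A) ×
                              SynFails (S ++ A)))

module Submission where

open import Defs
open import Data.List using (List; []; _∷_; _++_; map)
open import Relation.Nullary using (¬_; yes; no)
open import Data.Nat using (ℕ; suc; _+_; _≤_; s≤s)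
open import Data.Nat.Properties using (≤-refl; ≤-trans; m≤m+n; m≤n+m; <-irrefl; ≤-reflexive)
open import Data.Product using (_,_; proj₁; proj₂)
open import Data.Sum using (inj₁; inj₂)
open import Data.Vec using (Vec; []; _∷_)
open import Data.Vec.Properties using (∷-injective)
import Data.Vec.Relation.Unary.Any as VAny
open import Data.List.Relation.Unary.All using ([]; _∷_; lookup)
open import Data.List.Membership.Propositional using (_∈_)
open import Data.List.Relation.Unary.Any using (_─_)
open import Data.List.Relation.Unary.All.Properties using (─⁺; ++⁺; ++⁻ˡ; ++⁻ʳ)
open import Relation.Binary.Core using (Rel)
open import Relation.Binary.PropositionalEquality
open import Relation.Binary.Construct.Closure.ReflexiveTransitive using (Star; fold)
open import Function using (_∘_; id)

-- Every rule of Θ-unification (saturation, Store, syntactic unification)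
-- preserves the set of unifiers of store ∪ active set; Store merely moves an
-- equation between the two.  A unifier σ never meets a
-- failure: a clash f(…) ≐ g(…) has different heads after σ, and an occurs-check
-- equation x ≐ t with x a proper subterm of t would give σ x a proper subterm
-- of itself, i.e. size (σ x) < size (σ x).

Star-preserves : ∀ {I : Set} {ℓ} {T : Rel I ℓ} (P : I → Set) →
                 (∀ {i j} → T i j → P i → P j) → ∀ {i j} → Star T i j → P i → P j
Star-preserves P step = fold (λ i j → P i → P j) (λ t rest → rest ∘ step t) id

module _ (Sg : Signature) where
  open Signature Sg
  open Core Sg

  mutual
    ⟪⟫-∘ : (t : Term) (ρ σ : Var → Term) → t ⟪ ρ ⟫ ⟪ σ ⟫ ≡ t ⟪ (λ y → ρ y ⟪ σ ⟫) ⟫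
    ⟪⟫-∘ (var x)    ρ σ = refl
    ⟪⟫-∘ (fun f ts) ρ σ = cong (fun f) (⟪⟫*-∘ ts ρ σ)

    ⟪⟫*-∘ : ∀ {n} (ts : Vec Term n) (ρ σ : Var → Term) →
            ts ⟪ ρ ⟫* ⟪ σ ⟫* ≡ ts ⟪ (λ y → ρ y ⟪ σ ⟫) ⟫*
    ⟪⟫*-∘ []       ρ σ = refl
    ⟪⟫*-∘ (t ∷ ts) ρ σ = cong₂ _∷_ (⟪⟫-∘ t ρ σ) (⟪⟫*-∘ ts ρ σ)

  mutual
    ⟪⟫-cong : (t : Term) {ρ σ : Var → Term} → (∀ y → ρ y ≡ σ y) → t ⟪ ρ ⟫ ≡ t ⟪ σ ⟫
    ⟪⟫-cong (var x)    ρ≗σ = ρ≗σ x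
    ⟪⟫-cong (fun f ts) ρ≗σ = cong (fun f) (⟪⟫*-cong ts ρ≗σ)

    ⟪⟫*-cong : ∀ {n} (ts : Vec Term n) {ρ σ : Var → Term} →
               (∀ y → ρ y ≡ σ y) → ts ⟪ ρ ⟫* ≡ ts ⟪ σ ⟫*
    ⟪⟫*-cong []       ρ≗σ = refl
    ⟪⟫*-cong (t ∷ ts) ρ≗σ = cong₂ _∷_ (⟪⟫-cong t ρ≗σ) (⟪⟫*-cong ts ρ≗σ)

  mutual
    size : Term → ℕ
    size (var x)    = 1
    size (fun f ts) = suc (sizes ts)

    sizes : ∀ {n} → Vec Term n → ℕ
    sizes []       = 0
    sizes (t ∷ ts) = size t + sizes ts

  mutual
    size-occurs : ∀ {x} t (σ : Var → Term) → x occursIn t → size (σ x) ≤ size (t ⟪ σ ⟫)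
    size-occurs _          σ here      = ≤-refl
    size-occurs (fun f ts) σ (there a) = ≤-trans (sizes-occurs ts σ a) (m≤n+m _ 1)

    sizes-occurs : ∀ {x n} (ts : Vec Term n) (σ : Var → Term) →
                   VAny.Any (x occursIn_) ts → size (σ x) ≤ sizes (ts ⟪ σ ⟫*)
    sizes-occurs (t ∷ ts) σ (VAny.here p)  = ≤-trans (size-occurs t σ p) (m≤m+n _ _)
    sizes-occurs (t ∷ ts) σ (VAny.there a) = ≤-trans (sizes-occurs ts σ a) (m≤n+m _ _)

  occurs-check : ∀ {x} t (σ : Var → Term) → x occursIn t → t ≢ var x → σ x ≢ t ⟪ σ ⟫
  occurs-check _          σ here      t≢x  _  = t≢x refl
  occurs-check (fun f ts) σ (there a) _   eq =
    <-irrefl refl (≤-trans (s≤s (sizes-occurs ts σ a)) (≤-reflexive (cong size (sym eq))))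

  fun-injectiveˡ : ∀ {f g xs ys} → fun f xs ≡ fun g ys → f ≡ g
  fun-injectiveˡ refl = refl

  fun-injectiveʳ : ∀ {f xs ys} → fun f xs ≡ fun f ys → xs ≡ ys
  fun-injectiveʳ refl = refl

  zipEqs-unifier : ∀ σ {n} (ss ts : Vec Term n) → ss ⟪ σ ⟫* ≡ ts ⟪ σ ⟫* → Unifier σ (zipEqs ss ts)
  zipEqs-unifier σ []       []       _  = []
  zipEqs-unifier σ (s ∷ ss) (t ∷ ts) eq =
    proj₁ (∷-injective eq) ∷ zipEqs-unifier σ ss ts (proj₂ (∷-injective eq))

  decompose-unifier : ∀ σ {f ss ts U} (p : (fun f ss ≐ fun f ts) ∈ U) →
                      Unifier σ U → Unifier σ (zipEqs ss ts ++ (U ─ p))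
  decompose-unifier σ {ss = ss} {ts} p u =
    ++⁺ (zipEqs-unifier σ ss ts (fun-injectiveʳ (lookup u p))) (─⁺ p u)

  -- σ unifies x ≐ t, so it does not distinguish [ x ↦ t ] ; σ from σ.
  substEq-unifier : ∀ σ {x t} → σ x ≡ t ⟪ σ ⟫ → ∀ {U} → Unifier σ U →
                    Unifier σ (map (substEq [ x ↦ t ]) U)
  substEq-unifier σ {x} {t} σx≡tσ = go
    where
      σ≗[x↦t]σ : ∀ y → σ y ≡ [ x ↦ t ] y ⟪ σ ⟫
      σ≗[x↦t]σ y with x ≟V y
      ... | yes refl = σx≡tσ
      ... | no  _    = refl

      substEq-solved : ∀ l r → l ⟪ σ ⟫ ≡ r ⟪ σ ⟫ →
                       l ⟪ [ x ↦ t ] ⟫ ⟪ σ ⟫ ≡ r ⟪ [ x ↦ t ] ⟫ ⟪ σ ⟫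
      substEq-solved l r eq = begin
        l ⟪ [ x ↦ t ] ⟫ ⟪ σ ⟫             ≡⟨ ⟪⟫-∘ l [ x ↦ t ] σ ⟩
        l ⟪ (λ y → [ x ↦ t ] y ⟪ σ ⟫) ⟫  ≡⟨ ⟪⟫-cong l σ≗[x↦t]σ ⟨
        l ⟪ σ ⟫                           ≡⟨ eq ⟩
        r ⟪ σ ⟫                           ≡⟨ ⟪⟫-cong r σ≗[x↦t]σ ⟩
        r ⟪ (λ y → [ x ↦ t ] y ⟪ σ ⟫) ⟫  ≡⟨ ⟪⟫-∘ r [ x ↦ t ] σ ⟨
        r ⟪ [ x ↦ t ] ⟫ ⟪ σ ⟫             ∎
        where open ≡-Reasoning

      go : ∀ {U} → Unifier σ U → Unifier σ (map (substEq [ x ↦ t ]) U)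
      go {[]}          []       = []
      go {(l ≐ r) ∷ _} (e ∷ es) = substEq-solved l r e ∷ go es

  ⇒₁-unifier : ∀ σ {A B} → A ⇒₁ B → Unifier σ A → Unifier σ B
  ⇒₁-unifier σ (decomposition p)    u = decompose-unifier σ p u
  ⇒₁-unifier σ (orient-1 p _)       u = sym (lookup u p) ∷ ─⁺ p u
  ⇒₁-unifier σ (orient-2 p _)       u = sym (lookup u p) ∷ u
  ⇒₁-unifier σ (transitivity p q _) u = trans (sym (lookup u p)) (lookup u q) ∷ u
  ⇒₁-unifier σ (reflexive p)        u = ─⁺ p u

  ConfigUnifier : (Var → Term) → Config → Set
  ConfigUnifier σ (S , A) = Unifier σ (S ++ A)

  ⇒s-unifier : ∀ σ Θ {c c′} → Θ ⊢ c ⇒s c′ → ConfigUnifier σ c → ConfigUnifier σ c′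
  ⇒s-unifier σ Θ {S , A} (store p _) u =
    lookup (++⁻ʳ S u) p ∷ ++⁺ (++⁻ˡ S u) (─⁺ p (++⁻ʳ S u))

  ⇒ᵤ-unifier : ∀ σ {A B} → A ⇒ᵤ B → Unifier σ A → Unifier σ B
  ⇒ᵤ-unifier σ (delete p)          u = ─⁺ p u
  ⇒ᵤ-unifier σ (decompose p)       u = decompose-unifier σ p u
  ⇒ᵤ-unifier σ (orient p _)        u = sym (lookup u p) ∷ ─⁺ p u
  ⇒ᵤ-unifier σ (eliminate p _ _)   u = lookup u p ∷ substEq-unifier σ (lookup u p) (─⁺ p u)

  unifier⇒¬ClashIn : ∀ σ {A} → Unifier σ A → ¬ ClashIn A
  unifier⇒¬ClashIn σ u (f , g , ss , ts , f≢g , p) = f≢g (fun-injectiveˡ (lookup u p))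

  unifier⇒¬OccursFail : ∀ σ {A} → Unifier σ A → ¬ OccursFail A
  unifier⇒¬OccursFail σ u (x , t , p , x∈t , t≢x) = occurs-check t σ x∈t t≢x (lookup u p)

  unifier⇒¬SynFails : ∀ σ {A} → Unifier σ A → ¬ SynFails A
  unifier⇒¬SynFails σ u (_ , run , inj₁ clash) =
    unifier⇒¬ClashIn σ (Star-preserves (Unifier σ) (⇒ᵤ-unifier σ) run u) clash
  unifier⇒¬SynFails σ u (_ , run , inj₂ occ) =
    unifier⇒¬OccursFail σ (Star-preserves (Unifier σ) (⇒ᵤ-unifier σ) run u) occ

theorem3 : (Sg : Signature) (Θ : Core.Schema Sg) (U : List (Core.Eqn Sg)) →
           Core.Unifiable Sg U → ¬ Core.StoreIsBot Sg Θ U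
theorem3 Sg Θ U (σ , u) (inj₁ (_ , saturate , clash)) =
  unifier⇒¬ClashIn Sg σ (Star-preserves (Core.Unifier Sg σ) (⇒₁-unifier Sg σ) saturate u) clash
theorem3 Sg Θ U (σ , u) (inj₂ (_ , _ , _ , saturate , storing , _ , fails)) =
  unifier⇒¬SynFails Sg σ
    (Star-preserves (ConfigUnifier Sg σ) (⇒s-unifier Sg σ Θ) storing
      (Star-preserves (Core.Unifier Sg σ) (⇒₁-unifier Sg σ) saturate u))
    fails
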